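{- Assume in addition that $\mathcal C$ has binary products and all coproducts. Then for $T$-coalgebras $(X_1,\gamma_1)$ and $(X_2,\gamma_2)$ the map $T^\rho_{\gamma_1,\gamma_2}\colon\mathrm{Rel}(X_1,X_2)\to\mathrm{Rel}(X_1,X_2)$ has a greatest fixpoint, and this greatest fixpoint is $\rho$-bisimilarity, i.e. the join in $\mathrm{Rel}(X_1,X_2)$ of all $\rho$-bisimulations between $(X_1,\gamma_1)$ and $(X_2,\gamma_2)$.
   Context: $P\colon\mathcal C\to\mathcal A$, $S\colon\mathcal A\to\mathcal C$ are contravariant functors forming a dual adjunction (natural bijection $\mathcal C(X,SA)\cong\mathcal A(A,PX)$) with unit $\eta^{\mathcal C}\colon\mathrm{Id}_{\mathcal C}\to SP$. $T\colon\mathcal C\to\mathcal C$ is an endofunctor; a $T$-coalgebra is $(X,\gamma)$ with $\gamma\colon X\to TX$. $(L,\rho)$ is a logic: $L\colon\mathcal A\to\mathcal A$, $\rho\colon LP\to PT$ natural; complex algebra $\gamma^*=P\gamma\circ\rho_X$. Standing assumptions: $\mathcal C$ is finitely complete, well-powered, with an $(\mathcal E,\mathrm{Mono})$-factorisation system; $\mathcal A$ has pullbacks or $\mathcal C$ has pushouts. A span is jointly mono if $\pi_1h=\pi_1h'$ and $\pi_2h=\pi_2h'$ imply $h=h'$; $\mathrm{Rel}(X_1,X_2)$ is the poset of jointly mono spans up to isomorphism with $(B,\pi)\le(B',\pi')$ iff some $k\colon B\to B'$ has $\pi_i=\pi_i'k$; the join of a family $(B_i)$ is given by the $(\mathcal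 E,\mathrm{Mono})$-factorisation of $\coprod_iB_i\to X_1\times X_2$. The dual span $(\bar B,\bar\pi_1,\bar\pi_2)$ is the pullback in $\mathcal A$ of $PX_1\xrightarrow{P\pi_1}PB\xleftarrow{P\pi_2}PX_2$; $(B,\pi_1,\pi_2)$ is a $\rho$-bisimulation if $P\pi_1\circ\gamma_1^*\circ L\bar\pi_1=P\pi_2\circ\gamma_2^*\circ L\bar\pi_2$. With $\sigma_i=SL\bar\pi_i\circ S\rho_{X_i}\circ\eta^{\mathcal C}_{TX_i}\colon TX_i\to SL\bar B$, $T^\rho_{\gamma_1,\gamma_2}(B,\pi_1,\pi_2)$ is the pullback in $\mathcal C$ of $X_1\xrightarrow{\sigma_1\gamma_1}SL\bar B\xleftarrow{\sigma_2\gamma_2}X_2$. -}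

module Defs where

open import Level using (Level; _⊔_; suc)
open import Data.Product using (Σ; Σ-syntax; _×_; _,_)
open import Data.Sum using (_⊎_)
open import Relation.Binary using (Rel; IsEquivalence)

record Category (o ℓ : Level) : Set (suc (o ⊔ ℓ)) where
  infixr 9 _∘_
  infix  4 _≈_
  infix  4 _⇒_
  field
    Obj  : Set o
    _⇒_  : Obj → Obj → Set ℓ
    _≈_  : ∀ {A B} → Rel (A ⇒ B) ℓ
    id   : ∀ {A} → A ⇒ A
    _∘_  : ∀ {A B C} → B ⇒ C → A ⇒ B → A ⇒ C
    equiv     : ∀ {A B} → IsEquivalence (_≈_ {A} {B})
    assoc     : ∀ {A B C D} {f : A ⇒ B} {g : B ⇒ C} {h : C ⇒ D} →
                (h ∘ g) ∘ f ≈ h ∘ (g ∘ f)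
    identityˡ : ∀ {A B} {f : A ⇒ B} → id ∘ f ≈ f
    identityʳ : ∀ {A B} {f : A ⇒ B} → f ∘ id ≈ f
    ∘-resp-≈  : ∀ {A B C} {f h : B ⇒ C} {g i : A ⇒ B} →
                f ≈ h → g ≈ i → f ∘ g ≈ h ∘ i

record Functor {o ℓ o′ ℓ′ : Level} (C : Category o ℓ) (D : Category o′ ℓ′)
       : Set (o ⊔ ℓ ⊔ o′ ⊔ ℓ′) where
  private
    module C = Category C
    module D = Category D
  field
    F₀ : C.Obj → D.Obj
    F₁ : ∀ {X Y} → X C.⇒ Y → F₀ X D.⇒ F₀ Y
    identity     : ∀ {X} → F₁ (C.id {X}) D.≈ D.id
    homomorphism : ∀ {X Y Z} {f : X C.⇒ Y} {g : Y C.⇒ Z} →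
                   F₁ (g C.∘ f) D.≈ F₁ g D.∘ F₁ f
    F-resp-≈     : ∀ {X Y} {f g : X C.⇒ Y} → f C.≈ g → F₁ f D.≈ F₁ g

record CoFunctor {o ℓ o′ ℓ′ : Level} (C : Category o ℓ) (D : Category o′ ℓ′)
       : Set (o ⊔ ℓ ⊔ o′ ⊔ ℓ′) where
  private
    module C = Category C
    module D = Category D
  field
    F₀ : C.Obj → D.Obj
    F₁ : ∀ {X Y} → X C.⇒ Y → F₀ Y D.⇒ F₀ X
    identity     : ∀ {X} → F₁ (C.id {X}) D.≈ D.id
    homomorphism : ∀ {X Y Z} {f : X C.⇒ Y} {g : Y C.⇒ Z} →
                   F₁ (g C.∘ f) D.≈ F₁ f D.∘ F₁ g
    F-resp-≈     : ∀ {X Y} {f g : X C.⇒ Y} → f C.≈ g → F₁ f D.≈ F₁ g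

module Notions {o ℓ : Level} (C : Category o ℓ) where
  open Category C

  Mono : ∀ {A B} → A ⇒ B → Set (o ⊔ ℓ)
  Mono {A} f = ∀ {Z} (g h : Z ⇒ A) → f ∘ g ≈ f ∘ h → g ≈ h

  IsIso : ∀ {A B} → A ⇒ B → Set ℓ
  IsIso {A} {B} f = Σ[ g ∈ B ⇒ A ] (g ∘ f ≈ id × f ∘ g ≈ id)

  record IsPullback {Pb X Y Z : Obj} (p₁ : Pb ⇒ X) (p₂ : Pb ⇒ Y)
                    (f : X ⇒ Z) (g : Y ⇒ Z) : Set (o ⊔ ℓ) where
    field
      commute   : f ∘ p₁ ≈ g ∘ p₂
      universal : ∀ {Q} (q₁ : Q ⇒ X) (q₂ : Q ⇒ Y) → f ∘ q₁ ≈ g ∘ q₂ →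
                  Σ[ u ∈ Q ⇒ Pb ] ((p₁ ∘ u ≈ q₁ × p₂ ∘ u ≈ q₂) ×
                    (∀ (u′ : Q ⇒ Pb) → p₁ ∘ u′ ≈ q₁ → p₂ ∘ u′ ≈ q₂ → u′ ≈ u))

  record Pullback {X Y Z : Obj} (f : X ⇒ Z) (g : Y ⇒ Z) : Set (o ⊔ ℓ) where
    field
      P  : Obj
      p₁ : P ⇒ X
      p₂ : P ⇒ Y
      isPullback : IsPullback p₁ p₂ f g

  record IsPushout {Q X Y Z : Obj} (i₁ : X ⇒ Q) (i₂ : Y ⇒ Q)
                   (f : Z ⇒ X) (g : Z ⇒ Y) : Set (o ⊔ ℓ) where
    field
      commute   : i₁ ∘ f ≈ i₂ ∘ g
      universal : ∀ {R} (r₁ : X ⇒ R) (r₂ : Y ⇒ R) → r₁ ∘ f ≈ r₂ ∘ g →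
                  Σ[ u ∈ Q ⇒ R ] ((u ∘ i₁ ≈ r₁ × u ∘ i₂ ≈ r₂) ×
                    (∀ (u′ : Q ⇒ R) → u′ ∘ i₁ ≈ r₁ → u′ ∘ i₂ ≈ r₂ → u′ ≈ u))

  record Pushout {X Y Z : Obj} (f : Z ⇒ X) (g : Z ⇒ Y) : Set (o ⊔ ℓ) where
    field
      Q  : Obj
      i₁ : X ⇒ Q
      i₂ : Y ⇒ Q
      isPushout : IsPushout i₁ i₂ f g

  HasPullbacks : Set (o ⊔ ℓ)
  HasPullbacks = ∀ {X Y Z} (f : X ⇒ Z) (g : Y ⇒ Z) → Pullback f g

  HasPushouts : Set (o ⊔ ℓ)
  HasPushouts = ∀ {X Y Z} (f : Z ⇒ X) (g : Z ⇒ Y) → Pushout f g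

  record Terminal : Set (o ⊔ ℓ) where
    field
      ⊤      : Obj
      !      : ∀ {X} → X ⇒ ⊤
      !-uniq : ∀ {X} (h : X ⇒ ⊤) → h ≈ !

  record FinitelyComplete : Set (o ⊔ ℓ) where
    field
      terminal : Terminal
      pullback : HasPullbacks

  record Product (X Y : Obj) : Set (o ⊔ ℓ) where
    field
      X×Y : Obj
      π₁  : X×Y ⇒ X
      π₂  : X×Y ⇒ Y
      ⟨_,_⟩ : ∀ {Z} → Z ⇒ X → Z ⇒ Y → Z ⇒ X×Y
      project₁ : ∀ {Z} {f : Z ⇒ X} {g : Z ⇒ Y} → π₁ ∘ ⟨ f , g ⟩ ≈ f
      project₂ : ∀ {Z} {f : Z ⇒ X} {g : Z ⇒ Y} → π₂ ∘ ⟨ f , g ⟩ ≈ g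
      unique   : ∀ {Z} {f : Z ⇒ X} {g : Z ⇒ Y} (h : Z ⇒ X×Y) →
                 π₁ ∘ h ≈ f → π₂ ∘ h ≈ g → h ≈ ⟨ f , g ⟩

  BinaryProducts : Set (o ⊔ ℓ)
  BinaryProducts = ∀ X Y → Product X Y

  record Coproduct {I : Set ℓ} (F : I → Obj) : Set (o ⊔ ℓ) where
    field
      ∐    : Obj
      inj  : ∀ i → F i ⇒ ∐
      [_]  : ∀ {Z} → (∀ i → F i ⇒ Z) → ∐ ⇒ Z
      commute : ∀ {Z} {f : ∀ i → F i ⇒ Z} i → [ f ] ∘ inj i ≈ f i
      unique  : ∀ {Z} {f : ∀ i → F i ⇒ Z} (h : ∐ ⇒ Z) →
                (∀ i → h ∘ inj i ≈ f i) → h ≈ [ f ]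

  AllCoproducts : Set (o ⊔ suc ℓ)
  AllCoproducts = ∀ (I : Set ℓ) (F : I → Obj) → Coproduct F

  record WellPowered : Set (o ⊔ suc ℓ) where
    field
      Sub     : Obj → Set ℓ
      dom     : ∀ {X} → Sub X → Obj
      arr     : ∀ {X} (s : Sub X) → dom s ⇒ X
      arr-mono : ∀ {X} (s : Sub X) → Mono (arr s)
      complete : ∀ {X Y} (m : Y ⇒ X) → Mono m →
                 Σ[ s ∈ Sub X ] Σ[ k ∈ Y ⇒ dom s ] (IsIso k × arr s ∘ k ≈ m)

  record EMonoFactorisation : Set (o ⊔ suc ℓ) where
    field
      E        : ∀ {A B} → A ⇒ B → Set ℓ
      E-resp-≈ : ∀ {A B} {f g : A ⇒ B} → f ≈ g → E f → E g
      E-isoˡ   : ∀ {A B C} {e : A ⇒ B} {i : B ⇒ C} → E e → IsIso i → E (i ∘ e)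
      E-isoʳ   : ∀ {A B C} {i : A ⇒ B} {e : B ⇒ C} → IsIso i → E e → E (e ∘ i)
      factor   : ∀ {A B} (f : A ⇒ B) →
                 Σ[ M ∈ Obj ] Σ[ e ∈ A ⇒ M ] Σ[ m ∈ M ⇒ B ]
                   (E e × Mono m × m ∘ e ≈ f)
      diagonal : ∀ {A B C D} (e : A ⇒ B) (m : C ⇒ D) (u : A ⇒ C) (v : B ⇒ D) →
                 E e → Mono m → m ∘ u ≈ v ∘ e →
                 Σ[ d ∈ B ⇒ C ] ((d ∘ e ≈ u × m ∘ d ≈ v) ×
                   (∀ (d′ : B ⇒ C) → d′ ∘ e ≈ u → m ∘ d′ ≈ v → d′ ≈ d))

  record Span (X₁ X₂ : Obj) : Set (o ⊔ ℓ) where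
    field
      apex : Obj
      π₁   : apex ⇒ X₁
      π₂   : apex ⇒ X₂

  JointlyMono : ∀ {X₁ X₂} → Span X₁ X₂ → Set (o ⊔ ℓ)
  JointlyMono B = ∀ {Z} (h h′ : Z ⇒ apex) → π₁ ∘ h ≈ π₁ ∘ h′ → π₂ ∘ h ≈ π₂ ∘ h′ → h ≈ h′
    where open Span B

  -- elements of Rel(X₁,X₂): jointly mono spans
  record Relation (X₁ X₂ : Obj) : Set (o ⊔ ℓ) where
    field
      span        : Span X₁ X₂
      jointlyMono : JointlyMono span
    open Span span public

  infix 4 _≤ₛ_ _≅ₛ_
  _≤ₛ_ : ∀ {X₁ X₂} → Span X₁ X₂ → Span X₁ X₂ → Set ℓ
  B ≤ₛ B′ = Σ[ k ∈ B.apex ⇒ B′.apex ] (B′.π₁ ∘ k ≈ B.π₁ × B′.π₂ ∘ k ≈ B.π₂)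
    where module B = Span B
          module B′ = Span B′

  _≅ₛ_ : ∀ {X₁ X₂} → Span X₁ X₂ → Span X₁ X₂ → Set ℓ
  B ≅ₛ B′ = B ≤ₛ B′ × B′ ≤ₛ B

record DualAdjunction {o ℓ : Level} (C A : Category o ℓ)
       (P : CoFunctor C A) (S : CoFunctor A C) : Set (o ⊔ ℓ) where
  private
    module C = Category C
    module A = Category A
    module P = CoFunctor P
    module S = CoFunctor S
  field
    η   : ∀ X → X C.⇒ S.F₀ (P.F₀ X)
    ε   : ∀ B → B A.⇒ P.F₀ (S.F₀ B)
    η-natural : ∀ {X Y} (f : X C.⇒ Y) →
                S.F₁ (P.F₁ f) C.∘ η X C.≈ η Y C.∘ f
    ε-natural : ∀ {B D} (g : B A.⇒ D) →
                P.F₁ (S.F₁ g) A.∘ ε B A.≈ ε D A.∘ g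
    triangleC : ∀ B → S.F₁ (ε B) C.∘ η (S.F₀ B) C.≈ C.id
    triangleA : ∀ X → P.F₁ (η X) A.∘ ε (P.F₀ X) A.≈ A.id

record Logic {o ℓ : Level} {C A : Category o ℓ}
       (P : CoFunctor C A) (T : Functor C C) (L : Functor A A) : Set (o ⊔ ℓ) where
  private
    module C = Category C
    module A = Category A
    module P = CoFunctor P
    module T = Functor T
    module L = Functor L
  field
    ρ : ∀ X → L.F₀ (P.F₀ X) A.⇒ P.F₀ (T.F₀ X)
    ρ-natural : ∀ {X Y} (f : X C.⇒ Y) →
                P.F₁ (T.F₁ f) A.∘ ρ Y A.≈ ρ X A.∘ L.F₁ (P.F₁ f)

record Coalgebra {o ℓ : Level} {C : Category o ℓ} (T : Functor C C) : Set (o ⊔ ℓ) where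
  open Category C
  open Functor T
  field
    X : Obj
    γ : X ⇒ F₀ X

module Bisim {o ℓ : Level} {C A : Category o ℓ}
       {P : CoFunctor C A} {S : CoFunctor A C}
       (adj : DualAdjunction C A P S)
       {T : Functor C C} {L : Functor A A} (lg : Logic P T L)
       (fc : Notions.FinitelyComplete C)
       (c₁ c₂ : Coalgebra T) where
  private
    module C = Category C
    module A = Category A
    module P = CoFunctor P
    module S = CoFunctor S
    module T = Functor T
    module L = Functor L
    module NC = Notions C
    module NA = Notions A
    module c₁ = Coalgebra c₁
    module c₂ = Coalgebra c₂
  open DualAdjunction adj
  open Logic lg
  open NC using (Span)

  X₁ X₂ : C.Obj
  X₁ = c₁.X
  X₂ = c₂.X

  complex : (c : Coalgebra T) → L.F₀ (P.F₀ (Coalgebra.X c)) A.⇒ P.F₀ (Coalgebra.X c)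
  complex c = P.F₁ (Coalgebra.γ c) A.∘ ρ (Coalgebra.X c)

  record DualSpan (B : Span X₁ X₂) : Set (o ⊔ ℓ) where
    private module B = Span B
    field
      B̄   : A.Obj
      π̄₁  : B̄ A.⇒ P.F₀ X₁
      π̄₂  : B̄ A.⇒ P.F₀ X₂
      isPullback : NA.IsPullback π̄₁ π̄₂ (P.F₁ B.π₁) (P.F₁ B.π₂)

  BisimEq : (B : Span X₁ X₂) → DualSpan B → Set ℓ
  BisimEq B D =
    P.F₁ B.π₁ A.∘ complex c₁ A.∘ L.F₁ D.π̄₁ A.≈ P.F₁ B.π₂ A.∘ complex c₂ A.∘ L.F₁ D.π̄₂
    where module B = Span B
          module D = DualSpan D

  IsBisimulation : Span X₁ X₂ → Set (o ⊔ ℓ)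
  IsBisimulation B = Σ[ D ∈ DualSpan B ] BisimEq B D

  σ₁ : {B : Span X₁ X₂} (D : DualSpan B) → T.F₀ X₁ C.⇒ S.F₀ (L.F₀ (DualSpan.B̄ D))
  σ₁ D = S.F₁ (L.F₁ (DualSpan.π̄₁ D)) C.∘ S.F₁ (ρ X₁) C.∘ η (T.F₀ X₁)

  σ₂ : {B : Span X₁ X₂} (D : DualSpan B) → T.F₀ X₂ C.⇒ S.F₀ (L.F₀ (DualSpan.B̄ D))
  σ₂ D = S.F₁ (L.F₁ (DualSpan.π̄₂ D)) C.∘ S.F₁ (ρ X₂) C.∘ η (T.F₀ X₂)

  Tρ : (B : Span X₁ X₂) → DualSpan B → Span X₁ X₂
  Tρ B D = record { apex = Pb.P ; π₁ = Pb.p₁ ; π₂ = Pb.p₂ }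
    where
      module Pb = NC.Pullback
        (NC.FinitelyComplete.pullback fc (σ₁ D C.∘ c₁.γ) (σ₂ D C.∘ c₂.γ))

  open NC using (Relation; _≤ₛ_; _≅ₛ_)

  -- G is a greatest fixpoint of T^ρ on Rel(X₁,X₂)
  -- (T^ρ(G) computed w.r.t. any dual span of G; a dual span of G exists)
  IsGreatestFixpoint : Relation X₁ X₂ → Set (o ⊔ ℓ)
  IsGreatestFixpoint G =
    (DualSpan (Relation.span G) ×
     (∀ (D : DualSpan (Relation.span G)) → Tρ (Relation.span G) D ≅ₛ Relation.span G))
    × (∀ (B : Relation X₁ X₂) (D : DualSpan (Relation.span B)) →
         Tρ (Relation.span B) D ≅ₛ Relation.span B → Relation.span B ≤ₛ Relation.span G)

  IsBisimilarity : Relation X₁ X₂ → Set (o ⊔ ℓ)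
  IsBisimilarity G =
    (∀ (B : Relation X₁ X₂) → IsBisimulation (Relation.span B) →
       Relation.span B ≤ₛ Relation.span G)
    × (∀ (U : Relation X₁ X₂) →
         (∀ (B : Relation X₁ X₂) → IsBisimulation (Relation.span B) →
            Relation.span B ≤ₛ Relation.span U) →
         Relation.span G ≤ₛ Relation.span U)

{-# OPTIONS --safe #-}
-- Transposing along the dual adjunction turns the ρ-bisimulation equation for a span B into
-- commutativity of σ₁γ₁π₁ and σ₂γ₂π₂, i.e. into B ≤ T^ρ(B): ρ-bisimulations are exactly the
-- post-fixpoints of T^ρ.  Since T^ρ is monotone, the Knaster–Tarski argument applies to the
-- join G of all post-fixpoints (a small family by well-poweredness, joined as the image of
-- its coproduct): G ≤ T^ρ(G), hence T^ρ(G) is a post-fixpoint below G, so G is the greatest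
-- fixpoint and, being the join of the post-fixpoints, also ρ-bisimilarity.
module Submission where

open import Defs
open import Level using (Level; _⊔_)
open import Data.Product using (Σ; Σ-syntax; _×_; _,_; proj₁; proj₂)
open import Data.Sum using (_⊎_; inj₁; inj₂)
open import Relation.Binary.Bundles using (Setoid)
import Relation.Binary.Reasoning.Setoid as SetoidReasoning

module HomReasoning {o ℓ : Level} (𝒞 : Category o ℓ) where
  open Category 𝒞

  hom-setoid : ∀ {X Y} → Setoid ℓ ℓ
  hom-setoid {X} {Y} = record { Carrier = X ⇒ Y ; _≈_ = _≈_ ; isEquivalence = equiv }

  module _ {X Y : Obj} where
    open Setoid (hom-setoid {X} {Y}) public using (refl; sym; trans)
    open SetoidReasoning (hom-setoid {X} {Y}) public

  ∘-resp-≈ˡ : ∀ {X Y Z} {f h : Y ⇒ Z} {g : X ⇒ Y} → f ≈ h → f ∘ g ≈ h ∘ g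
  ∘-resp-≈ˡ p = ∘-resp-≈ p refl

  ∘-resp-≈ʳ : ∀ {X Y Z} {f : Y ⇒ Z} {g i : X ⇒ Y} → g ≈ i → f ∘ g ≈ f ∘ i
  ∘-resp-≈ʳ p = ∘-resp-≈ refl p

  sym-assoc : ∀ {W X Y Z} {f : W ⇒ X} {g : X ⇒ Y} {h : Y ⇒ Z} →
              h ∘ (g ∘ f) ≈ (h ∘ g) ∘ f
  sym-assoc = sym assoc

  pull-through : ∀ {W X Y Z} {f : W ⇒ X} {g : X ⇒ Y} {g′ : X ⇒ Z} {h : Y ⇒ Z} →
                 h ∘ g ≈ g′ → h ∘ (g ∘ f) ≈ g′ ∘ f
  pull-through p = trans sym-assoc (∘-resp-≈ˡ p)

module SpanOrder {o ℓ : Level} (𝒞 : Category o ℓ) where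
  open Category 𝒞
  open Notions 𝒞
  open HomReasoning 𝒞

  ≤ₛ-trans : ∀ {X Y} {B B′ B″ : Span X Y} → B ≤ₛ B′ → B′ ≤ₛ B″ → B ≤ₛ B″
  ≤ₛ-trans (k , k₁ , k₂) (k′ , k′₁ , k′₂) =
    k′ ∘ k , trans (pull-through k′₁) k₁ , trans (pull-through k′₂) k₂

  pullbackSpan : ∀ {X Y Z} {f : X ⇒ Z} {g : Y ⇒ Z} → Pullback f g → Span X Y
  pullbackSpan pb = record { apex = P ; π₁ = p₁ ; π₂ = p₂ }
    where open Pullback pb

  pullbackSpan-jointlyMono : ∀ {X Y Z} {f : X ⇒ Z} {g : Y ⇒ Z} (pb : Pullback f g) →
                             JointlyMono (pullbackSpan pb)
  pullbackSpan-jointlyMono {f = f} {g} pb h h′ e₁ e₂ with universal (p₁ ∘ h) (p₂ ∘ h) (square-∘ h)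
    where open Pullback pb
          open IsPullback isPullback
          square-∘ : ∀ {W} (h : W ⇒ P) → f ∘ (p₁ ∘ h) ≈ g ∘ (p₂ ∘ h)
          square-∘ h = trans sym-assoc (trans (∘-resp-≈ˡ commute) assoc)
  ... | _ , _ , unique = trans (unique h refl refl) (sym (unique h′ (sym e₁) (sym e₂)))

  ≤-pullbackSpan : ∀ {X Y Z} {f : X ⇒ Z} {g : Y ⇒ Z} (pb : Pullback f g) (B : Span X Y) →
                   f ∘ Span.π₁ B ≈ g ∘ Span.π₂ B → B ≤ₛ pullbackSpan pb
  ≤-pullbackSpan pb B commutes
    with IsPullback.universal (Pullback.isPullback pb) (Span.π₁ B) (Span.π₂ B) commutes
  ... | u , u-factors , _ = u , u-factors

  ≤-pullbackSpan⇒commutes : ∀ {X Y Z} {f : X ⇒ Z} {g : Y ⇒ Z} (pb : Pullback f g)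
                            (B : Span X Y) → B ≤ₛ pullbackSpan pb →
                            f ∘ Span.π₁ B ≈ g ∘ Span.π₂ B
  ≤-pullbackSpan⇒commutes {f = f} {g} pb B (k , k₁ , k₂) = begin
    f ∘ Span.π₁ B   ≈⟨ ∘-resp-≈ʳ k₁ ⟨
    f ∘ (p₁ ∘ k)    ≈⟨ pull-through commute ⟩
    (g ∘ p₂) ∘ k    ≈⟨ assoc ⟩
    g ∘ (p₂ ∘ k)    ≈⟨ ∘-resp-≈ʳ k₂ ⟩
    g ∘ Span.π₂ B   ∎
    where open Pullback pb
          open IsPullback isPullback

module RelationsAsSubobjects {o ℓ : Level} (𝒞 : Category o ℓ) {X₁ X₂ : Category.Obj 𝒞}
       (product : Notions.Product 𝒞 X₁ X₂) where
  open Category 𝒞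
  open Notions 𝒞
  open HomReasoning 𝒞
  open SpanOrder 𝒞
  open Product product

  ⟨⟩-ext : ∀ {Z} {f g : Z ⇒ X×Y} → π₁ ∘ f ≈ π₁ ∘ g → π₂ ∘ f ≈ π₂ ∘ g → f ≈ g
  ⟨⟩-ext {f = f} {g} p q = trans (unique f p q) (sym (unique g refl refl))

  spanOf : ∀ {M} → M ⇒ X×Y → Span X₁ X₂
  spanOf {M} m = record { apex = M ; π₁ = π₁ ∘ m ; π₂ = π₂ ∘ m }

  relationOf : ∀ {M} (m : M ⇒ X×Y) → Mono m → Relation X₁ X₂
  relationOf m m-mono = record
    { span = spanOf m
    ; jointlyMono = λ h h′ e₁ e₂ → m-mono h h′ (⟨⟩-ext (reassoc e₁) (reassoc e₂)) }
    where
      reassoc : ∀ {Z W} {p : X×Y ⇒ W} {h h′ : Z ⇒ _} →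
                (p ∘ m) ∘ h ≈ (p ∘ m) ∘ h′ → p ∘ (m ∘ h) ≈ p ∘ (m ∘ h′)
      reassoc e = trans sym-assoc (trans e assoc)

  pairing : (R : Relation X₁ X₂) → Relation.apex R ⇒ X×Y
  pairing R = ⟨ Relation.π₁ R , Relation.π₂ R ⟩

  pairing-mono : (R : Relation X₁ X₂) → Mono (pairing R)
  pairing-mono R g h e =
    Relation.jointlyMono R g h (cancel project₁) (cancel project₂)
    where
      cancel : ∀ {W} {p : X×Y ⇒ W} {r : Relation.apex R ⇒ W} → p ∘ pairing R ≈ r →
               r ∘ g ≈ r ∘ h
      cancel {p = p} {r} pr = begin
        r ∘ g                  ≈⟨ pull-through pr ⟨
        p ∘ (pairing R ∘ g)    ≈⟨ ∘-resp-≈ʳ e ⟩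
        p ∘ (pairing R ∘ h)    ≈⟨ pull-through pr ⟩
        r ∘ h                  ∎

  spanOf-≤ₛ : ∀ {M M′} {m : M ⇒ X×Y} {m′ : M′ ⇒ X×Y} (k : M′ ⇒ M) → m ∘ k ≈ m′ →
              spanOf m′ ≤ₛ spanOf m
  spanOf-≤ₛ k e = k , trans assoc (∘-resp-≈ʳ e) , trans assoc (∘-resp-≈ʳ e)

  span≅spanOf-pairing : (R : Relation X₁ X₂) → Relation.span R ≅ₛ spanOf (pairing R)
  span≅spanOf-pairing R =
    (id , trans identityʳ project₁ , trans identityʳ project₂) ,
    (id , trans identityʳ (sym project₁) , trans identityʳ (sym project₂))

  ≤ₛ⇒pairing-factors : (S R : Relation X₁ X₂) (le : Relation.span S ≤ₛ Relation.span R) →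
                       pairing R ∘ proj₁ le ≈ pairing S
  ≤ₛ⇒pairing-factors S R (k , k₁ , k₂) =
    ⟨⟩-ext (leg project₁ k₁ project₁) (leg project₂ k₂ project₂)
    where
      leg : ∀ {W} {p : X×Y ⇒ W} {r : Relation.apex R ⇒ W} {s : Relation.apex S ⇒ W} →
            p ∘ pairing R ≈ r → r ∘ k ≈ s → p ∘ pairing S ≈ s →
            p ∘ (pairing R ∘ k) ≈ p ∘ pairing S
      leg pR rk pS = trans (pull-through pR) (trans rk (sym pS))

  subobjectRelation : (wp : WellPowered) → WellPowered.Sub wp X×Y → Relation X₁ X₂
  subobjectRelation wp s = relationOf (arr s) (arr-mono s)
    where open WellPowered wp

  relation≅subobject : (wp : WellPowered) (R : Relation X₁ X₂) →
                       Σ[ s ∈ WellPowered.Sub wp X×Y ]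
                         (Relation.span R ≅ₛ Relation.span (subobjectRelation wp s))
  relation≅subobject wp R with WellPowered.complete wp (pairing R) (pairing-mono R)
  ... | s , k , (k⁻¹ , _ , k∘k⁻¹≈id) , arr∘k≈pairing =
    s , ≤ₛ-trans (proj₁ (span≅spanOf-pairing R)) (spanOf-≤ₛ k arr∘k≈pairing) ,
        ≤ₛ-trans (spanOf-≤ₛ k⁻¹ pairing∘k⁻¹≈arr) (proj₂ (span≅spanOf-pairing R))
    where
      pairing∘k⁻¹≈arr : pairing R ∘ k⁻¹ ≈ WellPowered.arr wp s
      pairing∘k⁻¹≈arr = begin
        pairing R ∘ k⁻¹                        ≈⟨ ∘-resp-≈ˡ arr∘k≈pairing ⟨
        (WellPowered.arr wp s ∘ k) ∘ k⁻¹       ≈⟨ assoc ⟩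
        WellPowered.arr wp s ∘ (k ∘ k⁻¹)       ≈⟨ ∘-resp-≈ʳ k∘k⁻¹≈id ⟩
        WellPowered.arr wp s ∘ id              ≈⟨ identityʳ ⟩
        WellPowered.arr wp s                   ∎

  IsJoin : {I : Set ℓ} → (I → Relation X₁ X₂) → Relation X₁ X₂ → Set (o ⊔ ℓ)
  IsJoin R G = (∀ i → Relation.span (R i) ≤ₛ Relation.span G)
             × (∀ U → (∀ i → Relation.span (R i) ≤ₛ Relation.span U) →
                  Relation.span G ≤ₛ Relation.span U)

  join : EMonoFactorisation → AllCoproducts →
         {I : Set ℓ} (R : I → Relation X₁ X₂) → Σ[ G ∈ Relation X₁ X₂ ] IsJoin R G
  join fs coprods {I} R = imageIsJoin (factor copairing)
    where
      open EMonoFactorisation fs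
      module ∐R = Coproduct (coprods I (λ i → Relation.apex (R i)))

      copairing : ∐R.∐ ⇒ X×Y
      copairing = ∐R.[ (λ i → pairing (R i)) ]

      imageIsJoin : Σ[ M ∈ Obj ] Σ[ e ∈ ∐R.∐ ⇒ M ] Σ[ m ∈ M ⇒ X×Y ]
                      (E e × Mono m × m ∘ e ≈ copairing) →
                    Σ[ G ∈ Relation X₁ X₂ ] IsJoin R G
      imageIsJoin (M , e , m , e∈E , m-mono , m∘e≈copairing) =
        relationOf m m-mono , upper , least
        where
          upper : ∀ i → Relation.span (R i) ≤ₛ spanOf m
          upper i = ≤ₛ-trans (proj₁ (span≅spanOf-pairing (R i)))
                      (spanOf-≤ₛ (e ∘ ∐R.inj i)
                        (trans (pull-through m∘e≈copairing) (∐R.commute i)))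

          least : ∀ U → (∀ i → Relation.span (R i) ≤ₛ Relation.span U) →
                  spanOf m ≤ₛ Relation.span U
          least U R≤U with diagonal e (pairing U) ∐R.[ ks ] m e∈E (pairing-mono U) square
            where
              ks : ∀ i → Relation.apex (R i) ⇒ Relation.apex U
              ks i = proj₁ (R≤U i)
              square : pairing U ∘ ∐R.[ ks ] ≈ m ∘ e
              square = trans (∐R.unique (pairing U ∘ ∐R.[ ks ])
                               (λ i → trans (trans assoc (∘-resp-≈ʳ (∐R.commute i)))
                                        (≤ₛ⇒pairing-factors (R i) U (R≤U i))))
                             (sym m∘e≈copairing)
          ... | d , (_ , pairing∘d≈m) , _ =
            ≤ₛ-trans (spanOf-≤ₛ d pairing∘d≈m) (proj₂ (span≅spanOf-pairing U))

module Transposition {o ℓ : Level} {C A : Category o ℓ} {P : CoFunctor C A} {S : CoFunctor A C}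
       (adj : DualAdjunction C A P S) where
  private
    module C = Category C
    module A = Category A
    module P = CoFunctor P
    module S = CoFunctor S
    module NC = Notions C
    module NA = Notions A
    module CR = HomReasoning C
    module AR = HomReasoning A
  open DualAdjunction adj

  transpose : ∀ {Z} Y → Z A.⇒ P.F₀ Y → Y C.⇒ S.F₀ Z
  transpose Y f = S.F₁ f C.∘ η Y

  untranspose : ∀ {Z} Y → Y C.⇒ S.F₀ Z → Z A.⇒ P.F₀ Y
  untranspose {Z} Y w = P.F₁ w A.∘ ε Z

  untranspose-transpose : ∀ {Z} Y (f : Z A.⇒ P.F₀ Y) → untranspose Y (transpose Y f) A.≈ f
  untranspose-transpose {Z} Y f = begin
    P.F₁ (S.F₁ f C.∘ η Y) A.∘ ε Z                  ≈⟨ ∘-resp-≈ˡ P.homomorphism ⟩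
    (P.F₁ (η Y) A.∘ P.F₁ (S.F₁ f)) A.∘ ε Z         ≈⟨ A.assoc ⟩
    P.F₁ (η Y) A.∘ (P.F₁ (S.F₁ f) A.∘ ε Z)         ≈⟨ ∘-resp-≈ʳ (ε-natural f) ⟩
    P.F₁ (η Y) A.∘ (ε (P.F₀ Y) A.∘ f)              ≈⟨ pull-through (triangleA Y) ⟩
    A.id A.∘ f                                     ≈⟨ A.identityˡ ⟩
    f                                              ∎
    where open HomReasoning A

  untranspose-∘ : ∀ {Z Y Y′} (w : Y C.⇒ S.F₀ Z) (h : Y′ C.⇒ Y) →
                  untranspose Y′ (w C.∘ h) A.≈ P.F₁ h A.∘ untranspose Y w
  untranspose-∘ w h = AR.trans (AR.∘-resp-≈ˡ P.homomorphism) A.assoc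

  transpose-injective : ∀ {Z} Y {f g : Z A.⇒ P.F₀ Y} →
                        transpose Y f C.≈ transpose Y g → f A.≈ g
  transpose-injective Y {f} {g} p = begin
    f                                ≈⟨ untranspose-transpose Y f ⟨
    untranspose Y (transpose Y f)    ≈⟨ ∘-resp-≈ˡ (P.F-resp-≈ p) ⟩
    untranspose Y (transpose Y g)    ≈⟨ untranspose-transpose Y g ⟩
    g                                ∎
    where open HomReasoning A

  transpose-P∘ : ∀ {Z Y Y′} (h : Y′ C.⇒ Y) (f : Z A.⇒ P.F₀ Y) →
                 transpose Y′ (P.F₁ h A.∘ f) C.≈ transpose Y f C.∘ h
  transpose-P∘ {Y = Y} {Y′} h f = begin
    S.F₁ (P.F₁ h A.∘ f) C.∘ η Y′              ≈⟨ ∘-resp-≈ˡ S.homomorphism ⟩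
    (S.F₁ f C.∘ S.F₁ (P.F₁ h)) C.∘ η Y′       ≈⟨ C.assoc ⟩
    S.F₁ f C.∘ (S.F₁ (P.F₁ h) C.∘ η Y′)       ≈⟨ ∘-resp-≈ʳ (η-natural h) ⟩
    S.F₁ f C.∘ (η Y C.∘ h)                    ≈⟨ sym-assoc ⟩
    (S.F₁ f C.∘ η Y) C.∘ h                    ∎
    where open HomReasoning C

  transpose-∘ : ∀ {Z Z′} Y (f : Z A.⇒ P.F₀ Y) (g : Z′ A.⇒ Z) →
                transpose Y (f A.∘ g) C.≈ S.F₁ g C.∘ transpose Y f
  transpose-∘ Y f g = CR.trans (CR.∘-resp-≈ˡ S.homomorphism) C.assoc

  P-pushout⇒pullback : ∀ {Q X Y Z} {i₁ : X C.⇒ Q} {i₂ : Y C.⇒ Q} {f : Z C.⇒ X} {g : Z C.⇒ Y} →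
                       NC.IsPushout i₁ i₂ f g →
                       NA.IsPullback (P.F₁ i₁) (P.F₁ i₂) (P.F₁ f) (P.F₁ g)
  P-pushout⇒pullback {Q} {X} {Y} {Z} {i₁} {i₂} {f} {g} pushout = record
    { commute = AR.trans (AR.sym P.homomorphism) (AR.trans (P.F-resp-≈ commute) P.homomorphism)
    ; universal = universal′ }
    where
      open NC.IsPushout pushout
      universal′ : ∀ {W} (q₁ : W A.⇒ P.F₀ X) (q₂ : W A.⇒ P.F₀ Y) →
                   P.F₁ f A.∘ q₁ A.≈ P.F₁ g A.∘ q₂ →
                   Σ[ u ∈ W A.⇒ P.F₀ Q ] ((P.F₁ i₁ A.∘ u A.≈ q₁ × P.F₁ i₂ A.∘ u A.≈ q₂) ×
                     (∀ (u′ : W A.⇒ P.F₀ Q) → P.F₁ i₁ A.∘ u′ A.≈ q₁ →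
                        P.F₁ i₂ A.∘ u′ A.≈ q₂ → u′ A.≈ u))
      universal′ {W} q₁ q₂ cone with universal (transpose X q₁) (transpose Y q₂) cocone
        where
          cocone : transpose X q₁ C.∘ f C.≈ transpose Y q₂ C.∘ g
          cocone = begin
            transpose X q₁ C.∘ f           ≈⟨ transpose-P∘ f q₁ ⟨
            transpose Z (P.F₁ f A.∘ q₁)    ≈⟨ ∘-resp-≈ˡ (S.F-resp-≈ cone) ⟩
            transpose Z (P.F₁ g A.∘ q₂)    ≈⟨ transpose-P∘ g q₂ ⟩
            transpose Y q₂ C.∘ g           ∎
            where open HomReasoning C
      ... | w , (w∘i₁≈ , w∘i₂≈) , w-unique =
        untranspose Q w , (leg w∘i₁≈ , leg w∘i₂≈) , unique′
        where
          leg : ∀ {V} {i : V C.⇒ Q} {q : W A.⇒ P.F₀ V} → w C.∘ i C.≈ transpose V q →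
                P.F₁ i A.∘ untranspose Q w A.≈ q
          leg {V} {i} {q} w∘i≈ = begin
            P.F₁ i A.∘ untranspose Q w       ≈⟨ untranspose-∘ w i ⟨
            untranspose V (w C.∘ i)          ≈⟨ ∘-resp-≈ˡ (P.F-resp-≈ w∘i≈) ⟩
            untranspose V (transpose V q)    ≈⟨ untranspose-transpose V q ⟩
            q                                ∎
            where open HomReasoning A

          unique′ : ∀ (u′ : W A.⇒ P.F₀ Q) → P.F₁ i₁ A.∘ u′ A.≈ q₁ →
                    P.F₁ i₂ A.∘ u′ A.≈ q₂ → u′ A.≈ untranspose Q w
          unique′ u′ e₁ e₂ = AR.trans (AR.sym (untranspose-transpose Q u′))
                                      (AR.∘-resp-≈ˡ (P.F-resp-≈ transpose≈w))
            where
              transpose-leg : ∀ {V} (i : V C.⇒ Q) {q : W A.⇒ P.F₀ V} → P.F₁ i A.∘ u′ A.≈ q →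
                              transpose Q u′ C.∘ i C.≈ transpose V q
              transpose-leg i e =
                CR.trans (CR.sym (transpose-P∘ i u′)) (CR.∘-resp-≈ˡ (S.F-resp-≈ e))
              transpose≈w : transpose Q u′ C.≈ w
              transpose≈w = w-unique (transpose Q u′) (transpose-leg i₁ e₁) (transpose-leg i₂ e₂)

module BisimulationsArePostfixpoints {o ℓ : Level} {C A : Category o ℓ}
       {P : CoFunctor C A} {S : CoFunctor A C} (adj : DualAdjunction C A P S)
       {T : Functor C C} {L : Functor A A} (lg : Logic P T L)
       (fc : Notions.FinitelyComplete C) (c₁ c₂ : Coalgebra T) where
  private
    module C = Category C
    module A = Category A
    module P = CoFunctor P
    module S = CoFunctor S
    module T = Functor T
    module L = Functor L
    module NC = Notions C
    module NA = Notions A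
    module CR = HomReasoning C
    module c₁ = Coalgebra c₁
    module c₂ = Coalgebra c₂
  open NC using (Span; Relation; _≤ₛ_)
  open SpanOrder C
  open Transposition adj
  open Logic lg
  open Bisim adj lg fc c₁ c₂

  -- σ₁ D and σ₂ D are, definitionally, σ c₁ (π̄₁ D) and σ c₂ (π̄₂ D).
  σ : (c : Coalgebra T) {B̄ : A.Obj} → B̄ A.⇒ P.F₀ (Coalgebra.X c) →
      T.F₀ (Coalgebra.X c) C.⇒ S.F₀ (L.F₀ B̄)
  σ c π̄ = S.F₁ (L.F₁ π̄) C.∘ transpose (T.F₀ X) (ρ X)
    where open Coalgebra c

  transpose-P∘complex∘L : (c : Coalgebra T) {B : C.Obj} {B̄ : A.Obj}
                          (π : B C.⇒ Coalgebra.X c) (π̄ : B̄ A.⇒ P.F₀ (Coalgebra.X c)) →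
                          transpose B (P.F₁ π A.∘ complex c A.∘ L.F₁ π̄) C.≈
                          (σ c π̄ C.∘ Coalgebra.γ c) C.∘ π
  transpose-P∘complex∘L c {B} π π̄ = begin
    transpose B (P.F₁ π A.∘ complex c A.∘ L.F₁ π̄)
      ≈⟨ transpose-P∘ π _ ⟩
    transpose X (complex c A.∘ L.F₁ π̄) C.∘ π
      ≈⟨ ∘-resp-≈ˡ (transpose-∘ X (complex c) (L.F₁ π̄)) ⟩
    (S.F₁ (L.F₁ π̄) C.∘ transpose X (P.F₁ γ A.∘ ρ X)) C.∘ π
      ≈⟨ ∘-resp-≈ˡ (∘-resp-≈ʳ (transpose-P∘ γ (ρ X))) ⟩
    (S.F₁ (L.F₁ π̄) C.∘ (transpose (T.F₀ X) (ρ X) C.∘ γ)) C.∘ π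
      ≈⟨ ∘-resp-≈ˡ sym-assoc ⟩
    (σ c π̄ C.∘ γ) C.∘ π
      ∎
    where open HomReasoning C
          open Coalgebra c

  pullbackTρ : (B : Span X₁ X₂) (D : DualSpan B) →
               NC.Pullback (σ₁ D C.∘ c₁.γ) (σ₂ D C.∘ c₂.γ)
  pullbackTρ B D = NC.FinitelyComplete.pullback fc _ _

  bisimulation⇒postfixpoint : (B : Span X₁ X₂) (D : DualSpan B) → BisimEq B D → B ≤ₛ Tρ B D
  bisimulation⇒postfixpoint B D bisim = ≤-pullbackSpan (pullbackTρ B D) B (begin
    (σ₁ D C.∘ c₁.γ) C.∘ B.π₁                                ≈⟨ transpose-P∘complex∘L c₁ _ _ ⟨
    transpose B.apex (P.F₁ B.π₁ A.∘ complex c₁ A.∘ L.F₁ D.π̄₁)  ≈⟨ ∘-resp-≈ˡ (S.F-resp-≈ bisim) ⟩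
    transpose B.apex (P.F₁ B.π₂ A.∘ complex c₂ A.∘ L.F₁ D.π̄₂)  ≈⟨ transpose-P∘complex∘L c₂ _ _ ⟩
    (σ₂ D C.∘ c₂.γ) C.∘ B.π₂                                ∎)
    where open HomReasoning C
          module B = Span B
          module D = DualSpan D

  postfixpoint⇒bisimulation : (B : Span X₁ X₂) (D : DualSpan B) → B ≤ₛ Tρ B D → BisimEq B D
  postfixpoint⇒bisimulation B D B≤TρB = transpose-injective (Span.apex B)
    (CR.trans (transpose-P∘complex∘L c₁ _ _)
      (CR.trans (≤-pullbackSpan⇒commutes (pullbackTρ B D) B B≤TρB)
        (CR.sym (transpose-P∘complex∘L c₂ _ _))))

  dualSpan-antitone : {B B′ : Span X₁ X₂} → B ≤ₛ B′ → (D : DualSpan B) (D′ : DualSpan B′) →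
                      Σ[ u ∈ DualSpan.B̄ D′ A.⇒ DualSpan.B̄ D ]
                        (DualSpan.π̄₁ D A.∘ u A.≈ DualSpan.π̄₁ D′ ×
                         DualSpan.π̄₂ D A.∘ u A.≈ DualSpan.π̄₂ D′)
  dualSpan-antitone {B} {B′} (k , k₁ , k₂) D D′
    with NA.IsPullback.universal (DualSpan.isPullback D) (DualSpan.π̄₁ D′) (DualSpan.π̄₂ D′) cone
    where
      open HomReasoning A
      module B = Span B
      module B′ = Span B′
      module D′ = DualSpan D′
      P-leg : ∀ {X} {b : B.apex C.⇒ X} {b′ : B′.apex C.⇒ X} → b′ C.∘ k C.≈ b →
              P.F₁ b A.≈ P.F₁ k A.∘ P.F₁ b′
      P-leg k-leg = trans (P.F-resp-≈ (CR.sym k-leg)) P.homomorphism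
      cone : P.F₁ B.π₁ A.∘ D′.π̄₁ A.≈ P.F₁ B.π₂ A.∘ D′.π̄₂
      cone = begin
        P.F₁ B.π₁ A.∘ D′.π̄₁                ≈⟨ ∘-resp-≈ˡ (P-leg k₁) ⟩
        (P.F₁ k A.∘ P.F₁ B′.π₁) A.∘ D′.π̄₁  ≈⟨ A.assoc ⟩
        P.F₁ k A.∘ (P.F₁ B′.π₁ A.∘ D′.π̄₁)  ≈⟨ ∘-resp-≈ʳ (NA.IsPullback.commute D′.isPullback) ⟩
        P.F₁ k A.∘ (P.F₁ B′.π₂ A.∘ D′.π̄₂)  ≈⟨ sym-assoc ⟩
        (P.F₁ k A.∘ P.F₁ B′.π₂) A.∘ D′.π̄₂  ≈⟨ ∘-resp-≈ˡ (P-leg k₂) ⟨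
        P.F₁ B.π₂ A.∘ D′.π̄₂                ∎
  ... | u , u-legs , _ = u , u-legs

  σ-∘ : (c : Coalgebra T) {B̄ B̄′ : A.Obj}
        {π̄ : B̄ A.⇒ P.F₀ (Coalgebra.X c)} {π̄′ : B̄′ A.⇒ P.F₀ (Coalgebra.X c)}
        (u : B̄′ A.⇒ B̄) → π̄ A.∘ u A.≈ π̄′ → σ c π̄′ C.≈ S.F₁ (L.F₁ u) C.∘ σ c π̄
  σ-∘ c u π̄∘u≈π̄′ = begin
    S.F₁ (L.F₁ _) C.∘ _                        ≈⟨ ∘-resp-≈ˡ (S.F-resp-≈ (L.F-resp-≈ π̄∘u≈π̄′)) ⟨
    S.F₁ (L.F₁ (_ A.∘ u)) C.∘ _                ≈⟨ ∘-resp-≈ˡ (S.F-resp-≈ L.homomorphism) ⟩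
    S.F₁ (L.F₁ _ A.∘ L.F₁ u) C.∘ _             ≈⟨ ∘-resp-≈ˡ S.homomorphism ⟩
    (S.F₁ (L.F₁ u) C.∘ S.F₁ (L.F₁ _)) C.∘ _    ≈⟨ C.assoc ⟩
    S.F₁ (L.F₁ u) C.∘ σ c _                    ∎
    where open HomReasoning C

  Tρ-monotone : {B B′ : Span X₁ X₂} → B ≤ₛ B′ → (D : DualSpan B) (D′ : DualSpan B′) →
                Tρ B D ≤ₛ Tρ B′ D′
  Tρ-monotone {B} {B′} B≤B′ D D′ with dualSpan-antitone B≤B′ D D′
  ... | u , u₁ , u₂ = ≤-pullbackSpan (pullbackTρ B′ D′) (Tρ B D) (begin
    (σ c₁ _ C.∘ c₁.γ) C.∘ p₁                        ≈⟨ ∘-resp-≈ˡ (∘-resp-≈ˡ (σ-∘ c₁ u u₁)) ⟩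
    ((S.F₁ (L.F₁ u) C.∘ σ c₁ _) C.∘ c₁.γ) C.∘ p₁    ≈⟨ reassoc ⟩
    S.F₁ (L.F₁ u) C.∘ ((σ c₁ _ C.∘ c₁.γ) C.∘ p₁)    ≈⟨ ∘-resp-≈ʳ commute ⟩
    S.F₁ (L.F₁ u) C.∘ ((σ c₂ _ C.∘ c₂.γ) C.∘ p₂)    ≈⟨ reassoc ⟨
    ((S.F₁ (L.F₁ u) C.∘ σ c₂ _) C.∘ c₂.γ) C.∘ p₂    ≈⟨ ∘-resp-≈ˡ (∘-resp-≈ˡ (σ-∘ c₂ u u₂)) ⟨
    (σ c₂ _ C.∘ c₂.γ) C.∘ p₂                        ∎)
    where
      open HomReasoning C
      open NC.Pullback (pullbackTρ B D)
      open NC.IsPullback isPullback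
      reassoc : ∀ {W X Y Z V} {a : Z C.⇒ V} {b : Y C.⇒ Z} {c : X C.⇒ Y} {d : W C.⇒ X} →
                ((a C.∘ b) C.∘ c) C.∘ d C.≈ a C.∘ ((b C.∘ c) C.∘ d)
      reassoc = trans (∘-resp-≈ˡ C.assoc) C.assoc

  TρRelation : (B : Span X₁ X₂) → DualSpan B → Relation X₁ X₂
  TρRelation B D = record
    { span = Tρ B D ; jointlyMono = pullbackSpan-jointlyMono (pullbackTρ B D) }

  dualSpan : NA.HasPullbacks ⊎ NC.HasPushouts → (B : Span X₁ X₂) → DualSpan B
  dualSpan (inj₁ pullbacks) B = record
    { B̄ = Pb.P ; π̄₁ = Pb.p₁ ; π̄₂ = Pb.p₂ ; isPullback = Pb.isPullback }
    where module Pb = NA.Pullback (pullbacks (P.F₁ (Span.π₁ B)) (P.F₁ (Span.π₂ B)))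
  dualSpan (inj₂ pushouts) B = record
    { B̄ = P.F₀ Q ; π̄₁ = P.F₁ i₁ ; π̄₂ = P.F₁ i₂ ; isPullback = P-pushout⇒pullback isPushout }
    where open NC.Pushout (pushouts (Span.π₁ B) (Span.π₂ B))

module GreatestPostfixpoint {o ℓ : Level} {C A : Category o ℓ}
  {P : CoFunctor C A} {S : CoFunctor A C} (adj : DualAdjunction C A P S)
  {T : Functor C C} {L : Functor A A} (lg : Logic P T L)
  (fc : Notions.FinitelyComplete C) (wp : Notions.WellPowered C)
  (fs : Notions.EMonoFactorisation C)
  (pb-or-po : Notions.HasPullbacks A ⊎ Notions.HasPushouts C)
  (prods : Notions.BinaryProducts C) (coprods : Notions.AllCoproducts C)
  (c₁ c₂ : Coalgebra T) where
  open Notions C using (Span; Relation; _≤ₛ_; WellPowered)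
  open SpanOrder C
  open Bisim adj lg fc c₁ c₂
  open BisimulationsArePostfixpoints adj lg fc c₁ c₂
  open Notions.Product (prods X₁ X₂) using (X×Y)
  open RelationsAsSubobjects C (prods X₁ X₂)

  dual : (B : Span X₁ X₂) → DualSpan B
  dual = dualSpan pb-or-po

  subobject : WellPowered.Sub wp X×Y → Relation X₁ X₂
  subobject = subobjectRelation wp

  -- Post-fixpoints are indexed by subobjects of X₁ × X₂ so that the family is small.
  PostfixedSubobject : Set ℓ
  PostfixedSubobject = Σ[ s ∈ WellPowered.Sub wp X×Y ] (Bₛ s ≤ₛ Tρ (Bₛ s) (dual (Bₛ s)))
    where Bₛ : WellPowered.Sub wp X×Y → Span X₁ X₂
          Bₛ s = Relation.span (subobject s)

  postfixedRelation : PostfixedSubobject → Relation X₁ X₂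
  postfixedRelation (s , _) = subobject s

  postfixpointJoin : Σ[ G ∈ Relation X₁ X₂ ] IsJoin postfixedRelation G
  postfixpointJoin = join fs coprods postfixedRelation

  G : Relation X₁ X₂
  G = proj₁ postfixpointJoin

  G-upper : ∀ p → Relation.span (postfixedRelation p) ≤ₛ Relation.span G
  G-upper = proj₁ (proj₂ postfixpointJoin)

  G-least : ∀ U → (∀ p → Relation.span (postfixedRelation p) ≤ₛ Relation.span U) →
            Relation.span G ≤ₛ Relation.span U
  G-least = proj₂ (proj₂ postfixpointJoin)

  postfixpoint⇒≤G : (B : Relation X₁ X₂) (D : DualSpan (Relation.span B)) →
                    Relation.span B ≤ₛ Tρ (Relation.span B) D → Relation.span B ≤ₛ Relation.span G
  postfixpoint⇒≤G B D B≤TρB with relation≅subobject wp B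
  ... | s , B≤s , s≤B = ≤ₛ-trans B≤s (G-upper (s , s-postfixed))
    where
      s-postfixed : Relation.span (subobject s) ≤ₛ Tρ (Relation.span (subobject s)) (dual _)
      s-postfixed = ≤ₛ-trans s≤B (≤ₛ-trans B≤TρB (Tρ-monotone B≤s D (dual _)))

  G-postfixpoint : (D : DualSpan (Relation.span G)) → Relation.span G ≤ₛ Tρ (Relation.span G) D
  G-postfixpoint D = G-least (TρRelation (Relation.span G) D)
    (λ p → ≤ₛ-trans (proj₂ p) (Tρ-monotone (G-upper p) (dual _) D))

  TρG≤G : (D : DualSpan (Relation.span G)) → Tρ (Relation.span G) D ≤ₛ Relation.span G
  TρG≤G D = postfixpoint⇒≤G (TρRelation _ D) (dual _) (Tρ-monotone (G-postfixpoint D) D (dual _))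

  G-isGreatestFixpoint : IsGreatestFixpoint G
  G-isGreatestFixpoint =
    (dual (Relation.span G) , λ D → TρG≤G D , G-postfixpoint D) ,
    λ B D TρB≅B → postfixpoint⇒≤G B D (proj₂ TρB≅B)

  G-isBisimilarity : IsBisimilarity G
  G-isBisimilarity =
    (λ B (D , bisim) → postfixpoint⇒≤G B D (bisimulation⇒postfixpoint _ D bisim)) ,
    λ U bisimulations≤U → G-least U λ (s , s-postfixed) →
      bisimulations≤U (subobject s) (dual _ , postfixpoint⇒bisimulation _ (dual _) s-postfixed)

corollary3p22 :
    ∀ {o ℓ : Level} (C A : Category o ℓ)
      (P : CoFunctor C A) (S : CoFunctor A C) (adj : DualAdjunction C A P S)
      (T : Functor C C) (L : Functor A A) (lg : Logic P T L)
      (fc : Notions.FinitelyComplete C)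
      (wp : Notions.WellPowered C)
      (fs : Notions.EMonoFactorisation C)
      (pb-or-po : Notions.HasPullbacks A ⊎ Notions.HasPushouts C)
      (prods : Notions.BinaryProducts C)
      (coprods : Notions.AllCoproducts C)
      (c₁ c₂ : Coalgebra T) →
      Σ[ G ∈ Notions.Relation C (Coalgebra.X c₁) (Coalgebra.X c₂) ]
        (Bisim.IsGreatestFixpoint adj lg fc c₁ c₂ G
         × Bisim.IsBisimilarity adj lg fc c₁ c₂ G)
corollary3p22 C A P S adj T L lg fc wp fs pb-or-po prods coprods c₁ c₂ =
  G , G-isGreatestFixpoint , G-isBisimilarity
  where open GreatestPostfixpoint adj lg fc wp fs pb-or-po prods coprods c₁ c₂
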